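{- A polyomino with $n$ tiles and $h$ holes is efficiently structured if and only if $h=M(n,h)$.
   Context: A polyomino is a finite union of closed unit squares (tiles) of the square lattice, any two of which intersect in nothing, a vertex, or an entire common edge, such that the interior of the union is connected. Holes are the bounded connected components of the complement; the area of a hole is the number of unit lattice squares in it. The dual graph has one vertex per tile and an edge between tiles sharing an edge; the polyomino is acyclic if its dual graph is a tree. The outer perimeter $p_o(A)$ is the number of unit edges of the boundary of $A$ not bounding a hole. Let $p_{\min}(k)=2\lceil2\sqrt k\,\rceil$; a polyomino with $n$ tiles and $h$ holes has minimal outer perimeter if $p_o(A)=p_{\min}(n+h)$, and is efficiently structured if it is acyclic, every hole has area one, and it has minimal outer perimeter. Let $M(n,h)=\frac{2n+2-p_{\min}(n+h)}{4}$. -}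

module Defs where

open import Data.Nat as ℕ using (ℕ; zero; suc; _≤_; _⊔_; _≤?_)
open import Data.Integer as ℤ using (ℤ; +_; ∣_∣)
open import Data.Product using (_×_; _,_; Σ; ∃; ∃-syntax)
open import Data.Product.Properties using (≡-dec)
open import Data.List using (List; []; _∷_; length; filter; concat; concatMap; map; last)
open import Data.List.Relation.Unary.All using (All)
open import Data.List.Relation.Unary.Unique.Propositional using (Unique)
open import Data.List.Relation.Unary.Linked using (Linked)
open import Data.Maybe using (just)
open import Data.Bool using (if_then_else_)
open import Data.Empty using (⊥)
open import Relation.Binary.PropositionalEquality using (_≡_)
open import Relation.Binary.Definitions using (DecidableEquality)
open import Relation.Nullary using (¬_; Dec; yes; no; ¬?; does)
open import Relation.Nullary.Decidable using (_×-dec_)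

-- Lattice cells: the unit square [x,x+1]×[y,y+1] is named by (x , y).

Cell : Set
Cell = ℤ × ℤ

_≟ᶜ_ : DecidableEquality Cell
_≟ᶜ_ = ≡-dec ℤ._≟_ ℤ._≟_

open import Data.List.Membership.DecPropositional _≟ᶜ_ public
  using (_∈_; _∉_; _∈?_)

neighbours : Cell → List Cell
neighbours (x , y) =
  (x ℤ.+ + 1 , y) ∷ (x ℤ.- + 1 , y) ∷ (x , y ℤ.+ + 1) ∷ (x , y ℤ.- + 1) ∷ []

Adj : Cell → Cell → Set
Adj c d = d ∈ neighbours c

‖_‖ : Cell → ℕ
‖ (x , y) ‖ = ∣ x ∣ ⊔ ∣ y ∣

data Path (P : Cell → Set) : Cell → Cell → Set where
  here : ∀ {c} → P c → Path P c c
  step : ∀ {c c' d} → P c → Adj c c' → Path P c' d → Path P c d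

-- Distinct lattice squares automatically meet in
-- nothing, a vertex or a full edge; the interior of the union is
-- connected iff the tiles are connected through shared edges.

Tile : List Cell → Cell → Set
Tile A c = c ∈ A

Empty : List Cell → Cell → Set
Empty A c = c ∉ A

record Polyomino (A : List Cell) : Set where
  field
    nonempty  : ¬ (A ≡ [])
    distinct  : Unique A
    connected : ∀ {s t} → s ∈ A → t ∈ A → Path (Tile A) s t

-- Holes.  The connected components of the complement of the union of
-- closed tiles correspond to the edge-connected components of empty
-- cells.  A hole is a bounded such component.

BoundedComponent : List Cell → Cell → Set
BoundedComponent A c = ∃[ N ] (∀ d → Path (Empty A) c d → ‖ d ‖ ≤ N)

record IsHole (A : List Cell) (H : List Cell) : Set where
  field
    nonempty  : ¬ (H ≡ [])
    distinct  : Unique H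
    empty     : All (Empty A) H
    closed    : ∀ {c d} → c ∈ H → Adj c d → d ∉ A → d ∈ H
    connected : ∀ {c d} → c ∈ H → d ∈ H → Path (Empty A) c d

record Holes (A : List Cell) (hs : List (List Cell)) : Set where
  field
    holes    : All (IsHole A) hs
    disjoint : Unique (concat hs)
    complete : ∀ c → c ∉ A → BoundedComponent A c → c ∈ concat hs

area : List Cell → ℕ
area = length

-- Outer perimeter: boundary unit edges (tile / empty-cell pairs) whose
-- empty side does not lie in a hole, i.e. lies in the unbounded component.

outerPerimeter : List Cell → List (List Cell) → ℕ
outerPerimeter A hs =
  length (filter (λ e → ¬? (proj₂' e ∈? A) ×-dec ¬? (proj₂' e ∈? concat hs))
                 (concatMap (λ t → map (λ d → t , d) (neighbours t)) A))
  where
  proj₂' : Cell × Cell → Cell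
  proj₂' (_ , d) = d

-- p_min(k) = 2 ⌈2 √k⌉.  Note ⌈2√k⌉ = ⌈√(4k)⌉ = least m with 4k ≤ m².

ceilSqrtFrom : ℕ → ℕ → ℕ → ℕ
ceilSqrtFrom x zero    m = m
ceilSqrtFrom x (suc f) m = if does (x ≤? m ℕ.* m) then m else ceilSqrtFrom x f (suc m)

ceilSqrt : ℕ → ℕ
ceilSqrt x = ceilSqrtFrom x x 0

pmin : ℕ → ℕ
pmin k = 2 ℕ.* ceilSqrt (4 ℕ.* k)

-- Dual graph acyclicity: no cycle v₀ v₁ … v_k (k ≥ 2) of distinct tiles
-- with consecutive ones and v_k, v₀ sharing an edge.

IsCycle : List Cell → List Cell → Set
IsCycle A []       = ⊥
IsCycle A (v ∷ vs) =
  (3 ≤ length (v ∷ vs)) × Unique (v ∷ vs) × All (Tile A) (v ∷ vs) ×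
  Linked Adj (v ∷ vs) × Σ Cell (λ w → (last (v ∷ vs) ≡ just w) × Adj w v)

Acyclic : List Cell → Set
Acyclic A = ∀ vs → ¬ IsCycle A vs

MinimalOuterPerimeter : List Cell → List (List Cell) → Set
MinimalOuterPerimeter A hs = outerPerimeter A hs ≡ pmin (length A ℕ.+ length hs)

EfficientlyStructured : List Cell → List (List Cell) → Set
EfficientlyStructured A hs =
  Acyclic A × All (λ H → area H ≡ 1) hs × MinimalOuterPerimeter A hs

-- "h = M(n,h)" with M(n,h) = (2n + 2 - p_min(n+h)) / 4, i.e. 4h = 2n+2-p_min(n+h) in ℤ
EqualsM : ℕ → ℕ → Set
EqualsM n h = + (4 ℕ.* h) ≡ (+ (2 ℕ.* n ℕ.+ 2)) ℤ.- (+ pmin (n ℕ.+ h))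

module Submission where

-- The proof counts unit edges.  For finite sets S, T of cells, contacts S T
-- counts the adjacent pairs in S × T and perimeter S the edges between S and
-- its complement, so contacts S S + perimeter S = 4|S|.  For A, with U the
-- set of hole cells, every non-tile neighbour of a tile is outer or in a hole;
-- this gives the perimeter identity 4n = 2e + p_o + Σ_H P(H), where e is the
-- number of dual edges.  After finite sums, indicators and adjacency, the file
-- proves a lower bound for each summand:
--   * e ≥ n - 1, with equality iff A is acyclic, by listing the tiles in a
--     build order where each tile is adjacent to a later one (dual-edges);
--   * p_o = P(A ∪ U) ≥ p_min(n + |U|) ≥ p_min(n + h), since a set meeting r
--     columns and c rows has at most rc cells and perimeter at least
--     2(r + c) ≥ p_min (isoperimetric);
--   * P(H) ≥ 4, with equality iff H is a single cell.
-- Hence 4h ≤ 2n + 2 - p_min(n + h), and the main theorem reads off that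
-- equality holds iff all three bounds are attained.

open import Defs
open import Data.Nat as ℕ using (ℕ; zero; suc; _+_; _*_; _∸_; _≤_; z≤n; s≤s)
import Data.Nat.Properties as ℕP
open import Data.Bool using (true; false; T)
open import Data.List using (List; []; _∷_; _++_; length; map; filter; concat; concatMap; head; last; deduplicate; cartesianProduct)
open import Data.Maybe using (just)
import Data.List.Properties as ListP
open import Data.List.Relation.Unary.All as All using (All; []; _∷_)
open import Data.List.Relation.Unary.All.Properties using (All¬⇒¬Any; ¬Any⇒All¬)
open import Data.List.Relation.Unary.Any using (Any; here; there; any?)
open import Data.List.Relation.Unary.AllPairs using ([]; _∷_)
open import Data.List.Relation.Unary.Linked using (Linked; [-]) renaming (_∷_ to _∷′_)
open import Data.List.Relation.Unary.Unique.Propositional using (Unique)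
open import Data.List.Relation.Unary.Unique.Propositional.Properties using (filter⁺; ++⁺)
open import Data.List.Relation.Unary.Unique.DecPropositional.Properties using (deduplicate-!)
import Data.List.Membership.Propositional as Mem
import Data.List.Membership.Propositional.Properties as MemP
open import Data.Integer as ℤ using (ℤ)
import Data.Integer.Properties as ℤP
open import Data.Integer.Tactic.RingSolver using (solve-∀)
open import Data.List.Extrema ℤP.≤-totalOrder using (argmax; argmax-all; f[xs]≤f[argmax])
open import Data.Product using (_×_; _,_; proj₁; proj₂; Σ; ∃-syntax)
open import Data.Sum using (inj₁; inj₂; [_,_]′)
open import Data.Empty using (⊥; ⊥-elim)
open import Data.Unit using (⊤; tt)
import Data.Nat.Tactic.RingSolver as ℕS
open import Relation.Binary.PropositionalEquality
open import Relation.Nullary using (¬_; Dec; yes; no; ¬?; _×-dec_)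
open import Function using (_∘_)
open import Function.Bundles using (_⇔_; mk⇔; Equivalence)
open import Function.Properties.Equivalence using () renaming (trans to ⇔-trans)
open import Algebra.Bundles using (AbelianGroup)
open import Algebra.Properties.Group (AbelianGroup.group ℤP.+-0-abelianGroup) using (∙-cancelˡ)
open import Algebra.Properties.CommutativeSemigroup ℕP.+-commutativeSemigroup using (interchange)

-- If a + b reaches the bound a' + b' and each summand is below its bound,
-- both bounds are attained.  This is how every equality case is extracted.
+-tight : ∀ {a b a' b'} → a ≤ a' → b ≤ b' → a' + b' ≡ a + b → a ≡ a' × b ≡ b'
+-tight {a} {b} {a'} {b'} a≤a' b≤b' eq =
  ℕP.≤-antisym a≤a' (ℕP.+-cancelʳ-≤ b a' a (ℕP.≤-trans (ℕP.+-monoʳ-≤ a' b≤b') (ℕP.≤-reflexive eq))) ,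
  ℕP.≤-antisym b≤b' (ℕP.+-cancelˡ-≤ a b' b (ℕP.≤-trans (ℕP.+-monoˡ-≤ b' a≤a') (ℕP.≤-reflexive eq)))

∑ : ∀ {X : Set} → (X → ℕ) → List X → ℕ
∑ f []       = 0
∑ f (x ∷ xs) = f x + ∑ f xs

module _ {X : Set} where

  ∑-++ : ∀ (f : X → ℕ) xs ys → ∑ f (xs ++ ys) ≡ ∑ f xs + ∑ f ys
  ∑-++ f []       ys = refl
  ∑-++ f (x ∷ xs) ys = trans (cong (f x +_) (∑-++ f xs ys)) (sym (ℕP.+-assoc (f x) _ _))

  ∑-+ : ∀ (f g : X → ℕ) xs → ∑ (λ x → f x + g x) xs ≡ ∑ f xs + ∑ g xs
  ∑-+ f g []       = refl
  ∑-+ f g (x ∷ xs) = trans (cong ((f x + g x) +_) (∑-+ f g xs)) (interchange (f x) (g x) (∑ f xs) (∑ g xs))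

  ∑-cong : ∀ {f g : X → ℕ} xs → (∀ {x} → x Mem.∈ xs → f x ≡ g x) → ∑ f xs ≡ ∑ g xs
  ∑-cong []       eq = refl
  ∑-cong (x ∷ xs) eq = cong₂ _+_ (eq (here refl)) (∑-cong xs (eq ∘ there))

  ∑-mono : ∀ {f g : X → ℕ} xs → (∀ {x} → x Mem.∈ xs → f x ≤ g x) → ∑ f xs ≤ ∑ g xs
  ∑-mono []       le = z≤n
  ∑-mono (x ∷ xs) le = ℕP.+-mono-≤ (le (here refl)) (∑-mono xs (le ∘ there))

  ∑-tight : ∀ {f g : X → ℕ} xs → (∀ {x} → x Mem.∈ xs → g x ≤ f x) → ∑ f xs ≡ ∑ g xs →
            ∀ {x} → x Mem.∈ xs → f x ≡ g x
  ∑-tight (y ∷ ys) le eq (here refl) = sym (proj₁ (+-tight (le (here refl)) (∑-mono ys (le ∘ there)) eq))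
  ∑-tight (y ∷ ys) le eq (there x∈) =
    ∑-tight ys (le ∘ there) (sym (proj₂ (+-tight (le (here refl)) (∑-mono ys (le ∘ there)) eq))) x∈

  ∑-const : ∀ k (xs : List X) → ∑ (λ _ → k) xs ≡ k * length xs
  ∑-const k []       = sym (ℕP.*-zeroʳ k)
  ∑-const k (x ∷ xs) = trans (cong (k +_) (∑-const k xs)) (sym (ℕP.*-suc k (length xs)))

  ∑-member : ∀ (f : X → ℕ) {x xs} → x Mem.∈ xs → f x ≤ ∑ f xs
  ∑-member f {xs = y ∷ ys} (here refl) = ℕP.m≤m+n (f y) (∑ f ys)
  ∑-member f {xs = y ∷ ys} (there x∈)  = ℕP.≤-trans (∑-member f x∈) (ℕP.m≤n+m (∑ f ys) (f y))

  ∑-two : ∀ (f : X → ℕ) {x y} xs → x ≢ y → x Mem.∈ xs → y Mem.∈ xs → f x + f y ≤ ∑ f xs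
  ∑-two f (z ∷ zs) x≢y (here refl) (here refl) = ⊥-elim (x≢y refl)
  ∑-two f (z ∷ zs) x≢y (here refl) (there y∈)  = ℕP.+-monoʳ-≤ (f z) (∑-member f y∈)
  ∑-two f {x} (z ∷ zs) x≢y (there x∈) (here refl) =
    subst (_≤ f z + ∑ f zs) (ℕP.+-comm (f z) (f x)) (ℕP.+-monoʳ-≤ (f z) (∑-member f x∈))
  ∑-two f (z ∷ zs) x≢y (there x∈) (there y∈) = ℕP.≤-trans (∑-two f zs x≢y x∈ y∈) (ℕP.m≤n+m (∑ f zs) (f z))

  ∑-map : ∀ {Y : Set} (g : Y → ℕ) (f : X → Y) xs → ∑ g (map f xs) ≡ ∑ (g ∘ f) xs
  ∑-map g f []       = refl
  ∑-map g f (x ∷ xs) = cong (g (f x) +_) (∑-map g f xs)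

∑-zero : ∀ {X : Set} (xs : List X) → ∑ (λ _ → 0) xs ≡ 0
∑-zero []       = refl
∑-zero (_ ∷ xs) = ∑-zero xs

∑-swap : ∀ {X Y : Set} (f : X → Y → ℕ) xs ys →
         ∑ (λ x → ∑ (f x) ys) xs ≡ ∑ (λ y → ∑ (λ x → f x y) xs) ys
∑-swap f []       ys = sym (∑-zero ys)
∑-swap f (x ∷ xs) ys = trans (cong (∑ (f x) ys +_) (∑-swap f xs ys)) (sym (∑-+ (f x) _ ys))

∑-concat : ∀ {X : Set} (f : X → ℕ) xss → ∑ f (concat xss) ≡ ∑ (∑ f) xss
∑-concat f []         = refl
∑-concat f (xs ∷ xss) = trans (∑-++ f xs (concat xss)) (cong (∑ f xs +_) (∑-concat f xss))

∑-length : ∀ {X : Set} (xs : List X) → ∑ (λ _ → 1) xs ≡ length xs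
∑-length xs = trans (∑-const 1 xs) (ℕP.*-identityˡ (length xs))

χ : ∀ {P : Set} → Dec P → ℕ
χ (yes _) = 1
χ (no _)  = 0

χ-yes : ∀ {P : Set} (P? : Dec P) → P → χ P? ≡ 1
χ-yes (yes _) _  = refl
χ-yes (no ¬p) p = ⊥-elim (¬p p)

χ-no : ∀ {P : Set} (P? : Dec P) → ¬ P → χ P? ≡ 0
χ-no (yes p) ¬p = ⊥-elim (¬p p)
χ-no (no _)  _  = refl

χ+χ¬ : ∀ {P : Set} (P? : Dec P) → χ P? + χ (¬? P?) ≡ 1
χ+χ¬ (yes _) = refl
χ+χ¬ (no _)  = refl

length-filter : ∀ {X : Set} {Q : X → Set} (Q? : ∀ x → Dec (Q x)) xs →
                length (filter Q? xs) ≡ ∑ (χ ∘ Q?) xs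
length-filter Q? []       = refl
length-filter Q? (x ∷ xs) with Q? x
... | yes _ = cong suc (length-filter Q? xs)
... | no _  = length-filter Q? xs

module _ {X : Set} where

  ∉-head : ∀ {x : X} {xs} → Unique (x ∷ xs) → ¬ (x Mem.∈ xs)
  ∉-head (x≢xs ∷ _) = All¬⇒¬Any x≢xs

  unique-tail : ∀ {x : X} {xs} → Unique (x ∷ xs) → Unique xs
  unique-tail (_ ∷ u) = u

  unique-⊆-length : ∀ xs {ys : List X} → Unique xs → (∀ {x} → x Mem.∈ xs → x Mem.∈ ys) →
                    length xs ≤ length ys
  unique-⊆-length []       u ⊆ys = z≤n
  unique-⊆-length (x ∷ xs) {ys} (x∉xs ∷ u) ⊆ys with MemP.∈-∃++ (⊆ys (here refl))
  ... | ys₁ , ys₂ , refl = ℕP.≤-trans (s≤s (unique-⊆-length xs u ⊆rest)) (ℕP.≤-reflexive (sym len))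
    where
    len : length (ys₁ ++ x ∷ ys₂) ≡ suc (length (ys₁ ++ ys₂))
    len = trans (ListP.length-++ ys₁) (trans (ℕP.+-suc (length ys₁) (length ys₂))
                                             (cong suc (sym (ListP.length-++ ys₁))))
    ⊆rest : ∀ {z} → z Mem.∈ xs → z Mem.∈ (ys₁ ++ ys₂)
    ⊆rest z∈ with MemP.∈-++⁻ ys₁ (⊆ys (there z∈))
    ... | inj₁ z∈₁         = MemP.∈-++⁺ˡ z∈₁
    ... | inj₂ (here refl) = ⊥-elim (All¬⇒¬Any x∉xs z∈)
    ... | inj₂ (there z∈₂) = MemP.∈-++⁺ʳ ys₁ z∈₂

length-pos : ∀ {X : Set} {x : X} {xs} → x Mem.∈ xs → 1 ≤ length xs
length-pos {xs = _ ∷ _} _ = s≤s z≤n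

nonempty-member : ∀ {X : Set} {xs : List X} → ¬ (xs ≡ []) → ∃[ x ] x Mem.∈ xs
nonempty-member {xs = []}    xs≢[] = ⊥-elim (xs≢[] refl)
nonempty-member {xs = x ∷ _} _     = x , here refl

length-cartesianProduct : ∀ {X Y : Set} (xs : List X) (ys : List Y) →
                          length (cartesianProduct xs ys) ≡ length xs * length ys
length-cartesianProduct []       ys = refl
length-cartesianProduct (x ∷ xs) ys =
  trans (ListP.length-++ (map (x ,_) ys))
        (cong₂ _+_ (ListP.length-map (x ,_) ys) (length-cartesianProduct xs ys))

offset-≢ : ∀ x {a b} → a ≢ b → x ℤ.+ a ≢ x ℤ.+ b
offset-≢ x a≢b eq = a≢b (∙-cancelˡ x _ _ eq)

x+1≢x : ∀ x → x ℤ.+ ℤ.+ 1 ≢ x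
x+1≢x x eq = offset-≢ x (λ ()) (trans eq (sym (ℤP.+-identityʳ x)))

x-1≢x : ∀ x → x ℤ.- ℤ.+ 1 ≢ x
x-1≢x x eq = offset-≢ x (λ ()) (trans eq (sym (ℤP.+-identityʳ x)))

x+1≢x-1 : ∀ x → x ℤ.+ ℤ.+ 1 ≢ x ℤ.- ℤ.+ 1
x+1≢x-1 x = offset-≢ x (λ ())

x+1-1≡x : ∀ x → x ℤ.+ ℤ.+ 1 ℤ.- ℤ.+ 1 ≡ x
x+1-1≡x = solve-∀

x-1+1≡x : ∀ x → x ℤ.- ℤ.+ 1 ℤ.+ ℤ.+ 1 ≡ x
x-1+1≡x = solve-∀

-[x-1]≡1-x : ∀ x → ℤ.- (x ℤ.- ℤ.+ 1) ≡ ℤ.+ 1 ℤ.+ ℤ.- x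
-[x-1]≡1-x = solve-∀

neighbours-unique : ∀ c → Unique (neighbours c)
neighbours-unique (x , y) =
  (x+1≢x-1 x ∘ cong proj₁ ∷ x+1≢x x ∘ cong proj₁ ∷ x+1≢x x ∘ cong proj₁ ∷ []) ∷
  (x-1≢x x ∘ cong proj₁ ∷ x-1≢x x ∘ cong proj₁ ∷ []) ∷
  (x+1≢x-1 y ∘ cong proj₂ ∷ []) ∷ [] ∷ []

adj-sym : ∀ {c d} → Adj c d → Adj d c
adj-sym {x , y} (here refl)                         = there (here (cong (_, y) (sym (x+1-1≡x x))))
adj-sym {x , y} (there (here refl))                 = here (cong (_, y) (sym (x-1+1≡x x)))
adj-sym {x , y} (there (there (here refl)))         = there (there (there (here (cong (x ,_) (sym (x+1-1≡x y))))))
adj-sym {x , y} (there (there (there (here refl)))) = there (there (here (cong (x ,_) (sym (x-1+1≡x y)))))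

adj-≢ : ∀ {c d} → Adj c d → c ≢ d
adj-≢ {x , y} (here eq)                         refl = x+1≢x x (sym (cong proj₁ eq))
adj-≢ {x , y} (there (here eq))                 refl = x-1≢x x (sym (cong proj₁ eq))
adj-≢ {x , y} (there (there (here eq)))         refl = x+1≢x y (sym (cong proj₂ eq))
adj-≢ {x , y} (there (there (there (here eq)))) refl = x-1≢x y (sym (cong proj₂ eq))

inside : Cell → List Cell → ℕ
inside c S = χ (c ∈? S)

outside : Cell → List Cell → ℕ
outside c S = χ (¬? (c ∈? S))

inside-yes : ∀ {c S} → c ∈ S → inside c S ≡ 1
inside-yes {c} {S} = χ-yes (c ∈? S)

inside-no : ∀ {c S} → c ∉ S → inside c S ≡ 0
inside-no {c} {S} = χ-no (c ∈? S)

outside-yes : ∀ {c S} → c ∉ S → outside c S ≡ 1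
outside-yes {c} {S} = χ-yes (¬? (c ∈? S))

outside-no : ∀ {c S} → c ∈ S → outside c S ≡ 0
outside-no {c} {S} c∈ = χ-no (¬? (c ∈? S)) (λ c∉ → c∉ c∈)

inside-iff : ∀ {c S S'} → (c ∈ S → c ∈ S') → (c ∈ S' → c ∈ S) → inside c S ≡ inside c S'
inside-iff {c} {S} {S'} to from with c ∈? S
... | yes c∈ = sym (inside-yes (to c∈))
... | no c∉  = sym (inside-no (c∉ ∘ from))

outside-iff : ∀ {c S S'} → (c ∈ S → c ∈ S') → (c ∈ S' → c ∈ S) → outside c S ≡ outside c S'
outside-iff {c} {S} {S'} to from with c ∈? S
... | yes c∈ = sym (outside-no (to c∈))
... | no c∉  = sym (outside-yes (c∉ ∘ from))

inside-complement : ∀ {c S S'} → (c ∈ S → c ∉ S') → (c ∉ S → c ∈ S') → inside c S ≡ outside c S'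
inside-complement {c} {S} {S'} excl cover with c ∈? S
... | yes c∈ = sym (outside-yes (excl c∈))
... | no c∉  = sym (outside-no (cover c∉))

inside-∷ : ∀ {x L} → x ∉ L → ∀ d → inside d (x ∷ L) ≡ χ (d ≟ᶜ x) + inside d L
inside-∷ {x} {L} x∉L d = by-cases (d ≟ᶜ x)
  where
  by-cases : (d≟x : Dec (d ≡ x)) → inside d (x ∷ L) ≡ χ d≟x + inside d L
  by-cases (yes refl) = trans (inside-yes (here refl)) (cong suc (sym (inside-no x∉L)))
  by-cases (no d≢x)   = inside-iff (λ { (here d≡x) → ⊥-elim (d≢x d≡x) ; (there d∈) → d∈ }) there

occurrences : ∀ x T → Unique T → ∑ (λ d → χ (d ≟ᶜ x)) T ≡ inside x T
occurrences x []      _ = refl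
occurrences x (y ∷ T) u with y ≟ᶜ x
... | yes refl = trans (cong suc (trans (∑-cong T (λ d∈ → χ-no (_ ≟ᶜ x) λ { refl → ∉-head u d∈ })) (∑-zero T)))
                       (sym (inside-yes (here refl)))
... | no y≢x   = trans (occurrences x T (unique-tail u))
                       (inside-iff there λ { (here x≡y) → ⊥-elim (y≢x (sym x≡y)) ; (there x∈) → x∈ })

overlap-sym : ∀ L T → Unique L → Unique T → ∑ (λ d → inside d T) L ≡ ∑ (λ d → inside d L) T
overlap-sym []      T uL uT = sym (∑-zero T)
overlap-sym (x ∷ L) T uL uT = begin
    inside x T + ∑ (λ d → inside d T) L
  ≡⟨ cong₂ _+_ (sym (occurrences x T uT)) (overlap-sym L T (unique-tail uL) uT) ⟩
    ∑ (λ d → χ (d ≟ᶜ x)) T + ∑ (λ d → inside d L) T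
  ≡⟨ sym (∑-+ (λ d → χ (d ≟ᶜ x)) (λ d → inside d L) T) ⟩
    ∑ (λ d → χ (d ≟ᶜ x) + inside d L) T
  ≡⟨ ∑-cong T (λ {d} _ → sym (inside-∷ (∉-head uL) d)) ⟩
    ∑ (λ d → inside d (x ∷ L)) T
  ∎
  where open ≡-Reasoning

neighboursIn : Cell → List Cell → ℕ
neighboursIn t T = ∑ (λ d → inside d T) (neighbours t)

neighboursOut : Cell → List Cell → ℕ
neighboursOut t T = ∑ (λ d → outside d T) (neighbours t)

contacts : List Cell → List Cell → ℕ
contacts S T = ∑ (λ s → neighboursIn s T) S

perimeter : List Cell → ℕ
perimeter S = ∑ (λ s → neighboursOut s S) S

neighboursIn+Out : ∀ t T → neighboursIn t T + neighboursOut t T ≡ 4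
neighboursIn+Out t T = trans (sym (∑-+ (λ d → inside d T) (λ d → outside d T) (neighbours t)))
  (trans (∑-cong (neighbours t) (λ {d} _ → χ+χ¬ (d ∈? T))) (∑-length (neighbours t)))

contacts+perimeter : ∀ S → contacts S S + perimeter S ≡ 4 * length S
contacts+perimeter S = trans (sym (∑-+ (λ t → neighboursIn t S) (λ t → neighboursOut t S) S))
  (trans (∑-cong S (λ {t} _ → neighboursIn+Out t S)) (∑-const 4 S))

contacts-≗ : ∀ S {T T'} → (∀ {c} → c ∈ T → c ∈ T') → (∀ {c} → c ∈ T' → c ∈ T) → contacts S T ≡ contacts S T'
contacts-≗ S T⊆T' T'⊆T = ∑-cong S (λ {t} _ → ∑-cong (neighbours t) (λ {d} _ → inside-iff {d} T⊆T' T'⊆T))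

contacts-sym : ∀ S T → Unique S → Unique T → contacts S T ≡ contacts T S
contacts-sym S T uS uT = begin
    ∑ (λ s → ∑ (λ d → inside d T) (neighbours s)) S
  ≡⟨ ∑-cong S (λ {s} _ → overlap-sym (neighbours s) T (neighbours-unique s) uT) ⟩
    ∑ (λ s → ∑ (λ t → inside t (neighbours s)) T) S
  ≡⟨ ∑-swap (λ s t → inside t (neighbours s)) S T ⟩
    ∑ (λ t → ∑ (λ s → inside t (neighbours s)) S) T
  ≡⟨ ∑-cong T (λ {t} _ → ∑-cong S (λ {s} _ → adjacency-sym t s)) ⟩
    ∑ (λ t → ∑ (λ s → inside s (neighbours t)) S) T
  ≡⟨ ∑-cong T (λ {t} _ → sym (overlap-sym (neighbours t) S (neighbours-unique t) uS)) ⟩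
    ∑ (λ t → ∑ (λ d → inside d S) (neighbours t)) T
  ∎
  where
  open ≡-Reasoning
  adjacency-sym : ∀ t s → inside t (neighbours s) ≡ inside s (neighbours t)
  adjacency-sym t s with t ∈? neighbours s
  ... | yes a = sym (inside-yes (adj-sym a))
  ... | no ¬a = sym (inside-no (¬a ∘ adj-sym))

module _ {Q : Cell → Set} where

  path-map : ∀ {R : Cell → Set} → (∀ {c} → Q c → R c) → ∀ {s t} → Path Q s t → Path R s t
  path-map f (here q)       = here (f q)
  path-map f (step q a rest) = step (f q) a (path-map f rest)

  path-start : ∀ {s t} → Path Q s t → Q s
  path-start (here q)     = q
  path-start (step q _ _) = q

  path-++ : ∀ {s t u} → Path Q s t → Path Q t u → Path Q s u
  path-++ (here _)        p = p
  path-++ (step q a rest) p = step q a (path-++ rest p)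

  path-reverse : ∀ {s t} → Path Q s t → Path Q t s
  path-reverse (here q)        = here q
  path-reverse (step q a rest) = path-++ (path-reverse rest) (step (path-start rest) (adj-sym a) (here q))

  vertices : ∀ {s t} → Path Q s t → List Cell
  after    : ∀ {s t} → Path Q s t → List Cell
  vertices {s} p = s ∷ after p
  after (here _)        = []
  after (step _ _ rest) = vertices rest

  vertices-all : ∀ {s t} (p : Path Q s t) → All Q (vertices p)
  vertices-all (here q)        = q ∷ []
  vertices-all (step q _ rest) = q ∷ vertices-all rest

  vertices-linked : ∀ {s t} (p : Path Q s t) → Linked Adj (vertices p)
  vertices-linked (here _)        = [-]
  vertices-linked (step _ a rest) = a ∷′ vertices-linked rest

  vertices-last : ∀ {s t} (p : Path Q s t) → last (vertices p) ≡ just t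
  vertices-last (here _)        = refl
  vertices-last (step _ _ rest) = vertices-last rest

  vertices-length : ∀ {s t} (p : Path Q s t) → s ≢ t → 2 ≤ length (vertices p)
  vertices-length (here _)     s≢t = ⊥-elim (s≢t refl)
  vertices-length (step _ _ _) _   = s≤s (s≤s z≤n)

  suffix : ∀ {s t c} (p : Path Q s t) → c ∈ vertices p → Unique (vertices p) →
           Σ (Path Q c t) (Unique ∘ vertices)
  suffix (here q)         (here refl) u = here q , u
  suffix (step q a rest)  (here refl) u = step q a rest , u
  suffix (step _ _ rest)  (there c∈)  u = suffix rest c∈ (unique-tail u)

  simple-path : ∀ {s t} → Path Q s t → Σ (Path Q s t) (Unique ∘ vertices)
  simple-path (here q) = here q , [] ∷ []
  simple-path {s} (step q a rest) with simple-path rest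
  ... | rest' , u with s ∈? vertices rest'
  ...   | yes s∈ = suffix rest' s∈ u
  ...   | no s∉  = step q a rest' , ¬Any⇒All¬ _ s∉ ∷ u

last-∈ : ∀ (L : List Cell) {w} → last L ≡ just w → w ∈ L
last-∈ (x ∷ [])     refl = here refl
last-∈ (x ∷ y ∷ L)  eq   = there (last-∈ (y ∷ L) eq)

last-snoc : ∀ (xs : List Cell) y → last (xs ++ y ∷ []) ≡ just y
last-snoc []           y = refl
last-snoc (x ∷ [])     y = refl
last-snoc (x ∷ x' ∷ xs) y = last-snoc (x' ∷ xs) y

linked-before : ∀ xs {y ys} → Linked Adj (xs ++ y ∷ ys) → xs ≢ [] → ∃[ p ] last xs ≡ just p × Adj p y
linked-before []            _           xs≢[] = ⊥-elim (xs≢[] refl)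
linked-before (x ∷ [])      (a ∷′ _)    _     = x , refl , a
linked-before (x ∷ x' ∷ xs) (_ ∷′ rest) _     = linked-before (x' ∷ xs) rest (λ ())

linked-after : ∀ xs {y s ys} → Linked Adj (xs ++ y ∷ s ∷ ys) → Adj y s
linked-after []            (a ∷′ _)    = a
linked-after (x ∷ [])      (_ ∷′ rest) = linked-after [] rest
linked-after (x ∷ x' ∷ xs) (_ ∷′ rest) = linked-after (x' ∷ xs) rest

unique-++-≢ : ∀ (xs : List Cell) {ys a b} → Unique (xs ++ ys) → a ∈ xs → b ∈ ys → a ≢ b
unique-++-≢ (x ∷ xs) (x∉ ∷ _) (here refl) b∈ refl = All¬⇒¬Any x∉ (MemP.∈-++⁺ʳ xs b∈)
unique-++-≢ (x ∷ xs) (_ ∷ u)  (there a∈)  b∈     = unique-++-≢ xs u a∈ b∈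

TwoNeighboursOn : List Cell → Cell → Set
TwoNeighboursOn C y = ∃[ p ] ∃[ s ] p ≢ s × p ∈ C × s ∈ C × Adj y p × Adj y s

-- A cycle written as pre ++ y ∷ post, closed by an edge from its last cell w
-- to its first cell v: the neighbours of y on the cycle are its predecessor
-- (w if y is first) and its successor (v if y is last).
cycle-around : ∀ pre y post {v w} → let C = pre ++ y ∷ post in
  3 ≤ length C → Unique C → Linked Adj C → head C ≡ just v → last C ≡ just w → Adj w v →
  TwoNeighboursOn C y
cycle-around [] y []             (s≤s ())
cycle-around [] y (s ∷ [])       (s≤s (s≤s ()))
cycle-around [] y (s ∷ s' ∷ rest) {w = w} _ u linked refl last≡w w~v =
  w , s , w≢s , there (there w∈) , there (here refl) , adj-sym w~v , linked-after [] linked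
  where
  w∈ : w ∈ s' ∷ rest
  w∈ = last-∈ (s' ∷ rest) last≡w
  w≢s : w ≢ s
  w≢s w≡s = ∉-head (unique-tail u) (subst (_∈ s' ∷ rest) w≡s w∈)
cycle-around (z ∷ pre) y [] len u linked refl last≡w w~v with linked-before (z ∷ pre) linked (λ ())
... | p , last≡p , p~y with trans (sym last≡w) (last-snoc (z ∷ pre) y)
...   | refl = p , z , p≢z pre last≡p len u , MemP.∈-++⁺ˡ (last-∈ (z ∷ pre) last≡p) , here refl , adj-sym p~y , w~v
  where
  p≢z : ∀ pre → last (z ∷ pre) ≡ just p → 3 ≤ length (z ∷ pre ++ y ∷ []) → Unique (z ∷ pre ++ y ∷ []) → p ≢ z
  p≢z []       _       (s≤s (s≤s ()))
  p≢z (q ∷ qs) last≡p _ u p≡z = ∉-head u (MemP.∈-++⁺ˡ (subst (_∈ q ∷ qs) p≡z (last-∈ (q ∷ qs) last≡p)))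
cycle-around (z ∷ pre) y (s ∷ post) len u linked _ _ _ with linked-before (z ∷ pre) linked (λ ())
... | p , last≡p , p~y =
  p , s , unique-++-≢ (z ∷ pre) u p∈ (there (here refl)) , MemP.∈-++⁺ˡ p∈ , MemP.∈-++⁺ʳ (z ∷ pre) (there (here refl)) ,
  adj-sym p~y , linked-after (z ∷ pre) linked
  where
  p∈ : p ∈ z ∷ pre
  p∈ = last-∈ (z ∷ pre) last≡p

cycle-neighbours : ∀ {A C y} → IsCycle A C → y ∈ C → TwoNeighboursOn C y
cycle-neighbours {C = v ∷ vs} (len , u , _ , linked , w , last≡w , w~v) y∈ with MemP.∈-∃++ y∈
... | pre , post , eq = subst (λ C → TwoNeighboursOn C _) (sym eq)
  (cycle-around pre _ post (subst (λ C → 3 ≤ length C) eq len) (subst Unique eq u) (subst (Linked Adj) eq linked)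
                (cong head (sym eq)) (trans (cong last (sym eq)) last≡w) w~v)

two-neighbours-in : ∀ x T → 2 ≤ neighboursIn x T → TwoNeighboursOn T x
two-neighbours-in x T two = two-of (filter (_∈? T) (neighbours x)) (filter⁺ (_∈? T) (neighbours-unique x))
  (ℕP.≤-trans two (ℕP.≤-reflexive (sym (length-filter (_∈? T) (neighbours x))))) (MemP.∈-filter⁻ (_∈? T))
  where
  two-of : ∀ F → Unique F → 2 ≤ length F → (∀ {d} → d ∈ F → d ∈ neighbours x × d ∈ T) → TwoNeighboursOn T x
  two-of (p ∷ [])    _                (s≤s ())
  two-of (p ∷ s ∷ _) ((p≢s ∷ _) ∷ _) _ ∈F with ∈F (here refl) | ∈F (there (here refl))
  ... | x~p , p∈ | x~s , s∈ = p , s , p≢s , p∈ , s∈ , x~p , x~s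

two-neighbours⇒2≤ : ∀ x T → TwoNeighboursOn T x → 2 ≤ neighboursIn x T
two-neighbours⇒2≤ x T (p , s , p≢s , p∈ , s∈ , x~p , x~s) =
  subst₂ (λ a b → a + b ≤ neighboursIn x T) (inside-yes p∈) (inside-yes s∈)
         (∑-two (λ d → inside d T) (neighbours x) p≢s x~p x~s)

-- Listing the tiles in such an order certifies connectivity,
-- and counting each dual edge at its earlier end counts it exactly once.
data BuildOrder : List Cell → Set where
  single : ∀ {x} → BuildOrder (x ∷ [])
  extend : ∀ {x d T} → d ∈ T → Adj x d → BuildOrder T → BuildOrder (x ∷ T)

build-connected : ∀ {L} → BuildOrder L → ∀ {u w} → u ∈ L → w ∈ L → Path (_∈ L) u w
build-connected single           (here refl) (here refl) = here (here refl)
build-connected (extend _ _ _)   (here refl) (here refl) = here (here refl)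
build-connected (extend d∈ a bT) (here refl) (there w∈)  =
  step (here refl) a (path-map there (build-connected bT d∈ w∈))
build-connected (extend d∈ a bT) (there u∈)  (here refl) =
  path-reverse (step (here refl) a (path-map there (build-connected bT d∈ u∈)))
build-connected (extend _ _ bT)  (there u∈)  (there w∈)  = path-map there (build-connected bT u∈ w∈)

laterContacts : List Cell → ℕ
laterContacts []      = 0
laterContacts (x ∷ T) = neighboursIn x T + laterContacts T

-- counting each adjacent pair at its earlier and at its later end
contacts-later : ∀ L → Unique L → contacts L L ≡ 2 * laterContacts L
contacts-later []      _ = refl
contacts-later (x ∷ T) u = begin
    neighboursIn x (x ∷ T) + contacts T (x ∷ T)
  ≡⟨ cong₂ _+_ not-self (contacts-sym T (x ∷ T) (unique-tail u) u) ⟩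
    neighboursIn x T + (neighboursIn x T + contacts T T)
  ≡⟨ cong (λ k → neighboursIn x T + (neighboursIn x T + k)) (contacts-later T (unique-tail u)) ⟩
    neighboursIn x T + (neighboursIn x T + 2 * laterContacts T)
  ≡⟨ double (neighboursIn x T) (laterContacts T) ⟩
    2 * (neighboursIn x T + laterContacts T)
  ∎
  where
  open ≡-Reasoning
  not-self : neighboursIn x (x ∷ T) ≡ neighboursIn x T
  not-self = ∑-cong (neighbours x) λ {d} x~d →
    inside-iff {d} {x ∷ T} (λ { (here d≡x) → ⊥-elim (adj-≢ x~d (sym d≡x)) ; (there d∈) → d∈ }) there
  double : ∀ a b → a + (a + 2 * b) ≡ 2 * (a + b)
  double = ℕS.solve-∀

has-neighbour-in : ∀ {x d T} → d ∈ T → Adj x d → 1 ≤ neighboursIn x T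
has-neighbour-in {x} {d} {T} d∈ x~d =
  subst (_≤ neighboursIn x T) (inside-yes d∈) (∑-member (λ d → inside d T) x~d)

build-length : ∀ {L} → BuildOrder L → length L ≤ suc (laterContacts L)
build-length single               = s≤s z≤n
build-length {x ∷ T} (extend d∈ x~d bT) =
  ℕP.≤-trans (ℕP.+-mono-≤ (has-neighbour-in d∈ x~d) (build-length bT))
             (ℕP.≤-reflexive (ℕP.+-suc (neighboursIn x T) (laterContacts T)))

TreeOrder : List Cell → Set
TreeOrder []      = ⊤
TreeOrder (x ∷ T) = neighboursIn x T ≤ 1 × TreeOrder T

tight⇒tree : ∀ {L} → BuildOrder L → suc (laterContacts L) ≡ length L → TreeOrder L
tight⇒tree single             _  = z≤n , tt
tight⇒tree {x ∷ T} (extend d∈ x~d bT) eq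
  with +-tight (has-neighbour-in d∈ x~d) (build-length bT) (trans (ℕP.+-suc (neighboursIn x T) (laterContacts T)) eq)
... | one , rest = ℕP.≤-reflexive (sym one) , tight⇒tree bT (sym rest)

tree⇒tight : ∀ {L} → BuildOrder L → TreeOrder L → suc (laterContacts L) ≡ length L
tree⇒tight single             _          = refl
tree⇒tight {x ∷ T} (extend d∈ x~d bT) (≤1 , tT) =
  trans (cong (λ a → suc (a + laterContacts T)) (ℕP.≤-antisym ≤1 (has-neighbour-in d∈ x~d))) (cong suc (tree⇒tight bT tT))

-- In an acyclic polyomino every build order of its tiles is a tree order:
-- two later neighbours of x would be joined by a path through later cells,
-- which closes up with x into a cycle.
acyclic⇒tree : ∀ {A} → Acyclic A → ∀ {L} → Unique L → All (Tile A) L → BuildOrder L → TreeOrder L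
acyclic⇒tree ac         u        tiles        single             = z≤n , tt
acyclic⇒tree {A} ac {x ∷ T} u (x∈A ∷ tiles) (extend _ _ bT) with neighboursIn x T ℕ.≤? 1
... | yes ≤1 = ≤1 , acyclic⇒tree ac (unique-tail u) tiles bT
... | no  >1 with two-neighbours-in x T (ℕP.≰⇒> >1)
...   | p , s , p≢s , p∈ , s∈ , x~p , x~s with simple-path (build-connected bT p∈ s∈)
...     | q , simple = ⊥-elim (ac (x ∷ vertices q) cycle)
  where
  x∉q : x ∉ vertices q
  x∉q x∈q = ∉-head u (All.lookup (vertices-all q) x∈q)
  cycle : IsCycle A (x ∷ vertices q)
  cycle = s≤s (vertices-length q p≢s) , (¬Any⇒All¬ _ x∉q ∷ simple) ,
          (x∈A ∷ All.map (All.lookup tiles) (vertices-all q)) ,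
          (x~p ∷′ vertices-linked q) , s , vertices-last q , adj-sym x~s

-- Conversely, a tree order contains no cycle: the first cell of the order
-- lying on a cycle would have two later neighbours on it.
tree⇒no-cycle : ∀ {A L} → TreeOrder L → ∀ {C} → IsCycle A C → All (_∈ L) C → ⊥
tree⇒no-cycle {L = []}    _          {v ∷ _} _  (() ∷ _)
tree⇒no-cycle {L = y ∷ T} (≤1 , tT) {C}      cy onL with y ∈? C
... | yes y∈C = ℕP.<⇒≱ (s≤s ≤1) (two-neighbours⇒2≤ y T (later-neighbours (cycle-neighbours cy y∈C)))
  where
  later : ∀ {c} → c ∈ C → Adj y c → c ∈ T
  later c∈ y~c with All.lookup onL c∈
  ... | here c≡y  = ⊥-elim (adj-≢ y~c (sym c≡y))
  ... | there c∈T = c∈T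
  later-neighbours : TwoNeighboursOn C y → TwoNeighboursOn T y
  later-neighbours (p , s , p≢s , p∈ , s∈ , y~p , y~s) = p , s , p≢s , later p∈ y~p , later s∈ y~s , y~p , y~s
... | no y∉C = tree⇒no-cycle tT cy (All.tabulate in-tail)
  where
  in-tail : ∀ {c} → c ∈ C → c ∈ T
  in-tail c∈ with All.lookup onL c∈
  ... | here refl = ⊥-elim (y∉C c∈)
  ... | there c∈T = c∈T

record Enumeration (A : List Cell) : Set where
  field
    order    : List Cell
    unique   : Unique order
    sound    : All (Tile A) order
    complete : ∀ {c} → c ∈ A → c ∈ order
    build    : BuildOrder order

Frontier : List Cell → Cell → Set
Frontier L a = a ∉ L × Any (_∈ L) (neighbours a)

frontier? : ∀ L a → Dec (Frontier L a)
frontier? L a with a ∈? L | any? (_∈? L) (neighbours a)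
... | yes a∈ | _       = no (λ f → proj₁ f a∈)
... | no a∉  | yes nb  = yes (a∉ , nb)
... | no a∉  | no ¬nb  = no (¬nb ∘ proj₂)

path-stays : ∀ {A L} → ¬ Any (Frontier L) A → ∀ {s t} → Path (Tile A) s t → s ∈ L → t ∈ L
path-stays _  (here _) s∈ = s∈
path-stays {A} {L} none (step _ a rest) s∈ with _ ∈? L
... | yes s'∈ = path-stays none rest s'∈
... | no  s'∉ = ⊥-elim (none (Mem.lose (path-start rest) (s'∉ , Mem.lose (adj-sym a) s∈)))

-- Grow a build order inside a connected A by adding frontier tiles; the fuel
-- bounds the number of tiles still missing.
grow : ∀ {A} → Polyomino A → ∀ fuel L → Unique L → All (Tile A) L → BuildOrder L →
       length A ≤ length L + fuel → Enumeration A
grow {A} pA fuel L u tiles b bound with any? (frontier? L) A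
grow {A} pA fuel (x ∷ L') u tiles b bound | no none =
  record { order = x ∷ L' ; unique = u ; sound = tiles ; build = b
         ; complete = λ c∈A → path-stays none (Polyomino.connected pA (All.lookup tiles (here refl)) c∈A) (here refl) }
grow {A} pA fuel L u tiles b bound | yes frontier with Mem.find frontier
... | a , a∈A , a∉L , adjacent with Mem.find adjacent
...   | d , a~d , d∈L = more fuel bound
  where
  u' : Unique (a ∷ L)
  u' = ¬Any⇒All¬ L a∉L ∷ u
  more : ∀ fuel → length A ≤ length L + fuel → Enumeration A
  more zero    bound = ⊥-elim (ℕP.<⇒≱ (unique-⊆-length (a ∷ L) u' (All.lookup (a∈A ∷ tiles)))
                                       (ℕP.≤-trans bound (ℕP.≤-reflexive (ℕP.+-identityʳ (length L)))))
  more (suc k) bound = grow pA k (a ∷ L) u' (a∈A ∷ tiles) (extend d∈L a~d b)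
                             (ℕP.≤-trans bound (ℕP.≤-reflexive (ℕP.+-suc (length L) k)))

enumerate : ∀ {A} → Polyomino A → Enumeration A
enumerate {[]}     pA = ⊥-elim (Polyomino.nonempty pA refl)
enumerate {a ∷ A'} pA = grow pA (length (a ∷ A')) (a ∷ []) ([] ∷ []) (here refl ∷ []) single
                               (ℕP.m≤n+m (length (a ∷ A')) 1)

record DualEdges (A : List Cell) : Set where
  field
    edges        : ℕ
    double-count : contacts A A ≡ 2 * edges
    spanning     : length A ≤ suc edges
    tree-iff     : Acyclic A ⇔ suc edges ≡ length A

dual-edges : ∀ {A} → Polyomino A → DualEdges A
dual-edges {A} pA = record
  { edges        = laterContacts order
  ; double-count = trans (contacts-≗ A complete inA) (trans (contacts-sym A order uA unique)
                   (trans (contacts-≗ order complete inA) (contacts-later order unique)))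
  ; spanning     = subst (_≤ suc (laterContacts order)) same-length (build-length build)
  ; tree-iff     = mk⇔ (λ ac → trans (tree⇒tight build (acyclic⇒tree ac unique sound build)) same-length)
                       (λ eq C cy → tree⇒no-cycle (tight⇒tree build (trans eq (sym same-length))) cy
                                      (All.map complete (cycle-tiles C cy)))
  }
  where
  open Enumeration (enumerate pA)
  uA : Unique A
  uA = Polyomino.distinct pA
  inA : ∀ {c} → c ∈ order → c ∈ A
  inA = All.lookup sound
  same-length : length order ≡ length A
  same-length = ℕP.≤-antisym (unique-⊆-length order unique inA) (unique-⊆-length A uA complete)
  cycle-tiles : ∀ C → IsCycle A C → All (Tile A) C
  cycle-tiles (_ ∷ _) (_ , _ , tiles , _) = tiles

-- A direction on the lattice: shift moves a cell one step along the
-- coordinate k while keeping the row coordinate l.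
module Direction (k l : Cell → ℤ) (shift : Cell → Cell)
                 (same-row : ∀ c → l (shift c) ≡ l c) (advance : ∀ c → k (shift c) ≡ ℤ.suc (k c)) where

  exposed : List Cell → List Cell
  exposed S = filter (λ t → ¬? (shift t ∈? S)) S

  -- the farthest cell of S in the row of t0 is exposed
  exposed-in-row : ∀ S {t0} → t0 ∈ S → ∃[ t ] t ∈ exposed S × l t ≡ l t0
  exposed-in-row S {t0} t0∈ = t , MemP.∈-filter⁺ (λ t → ¬? (shift t ∈? S)) t∈ shift-t∉ , same
    where
    row : List Cell
    row = filter (λ t → l t ℤ.≟ l t0) S
    t : Cell
    t = argmax k t0 row
    t-in-row : t ∈ S × l t ≡ l t0
    t-in-row = argmax-all k (t0∈ , refl) (All.tabulate (MemP.∈-filter⁻ (λ t → l t ℤ.≟ l t0)))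
    t∈ : t ∈ S
    t∈ = proj₁ t-in-row
    same : l t ≡ l t0
    same = proj₂ t-in-row
    shift-t∉ : shift t ∉ S
    shift-t∉ shift-t∈ = ℤP.i≮i (ℤP.suc[i]≤j⇒i<j (subst (ℤ._≤ k t) (advance t) farthest))
      where
      farthest : k (shift t) ℤ.≤ k t
      farthest = All.lookup (f[xs]≤f[argmax] {f = k} t0 row)
                   (MemP.∈-filter⁺ (λ t → l t ℤ.≟ l t0) shift-t∈ (trans (same-row t) same))

  rows : List Cell → List ℤ
  rows S = deduplicate ℤ._≟_ (map l S)

  -- each row contains an exposed cell
  rows≤exposed : ∀ S → length (rows S) ≤ length (exposed S)
  rows≤exposed S = ℕP.≤-trans (unique-⊆-length (rows S) (deduplicate-! ℤ._≟_ (map l S)) row-exposed)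
                              (ℕP.≤-reflexive (ListP.length-map l (exposed S)))
    where
    row-exposed : ∀ {y} → y Mem.∈ rows S → y Mem.∈ map l (exposed S)
    row-exposed y∈ with MemP.∈-map⁻ l (MemP.∈-deduplicate⁻ ℤ._≟_ (map l S) y∈)
    ... | t0 , t0∈ , refl with exposed-in-row S t0∈
    ...   | t , t∈ , same = subst (Mem._∈ map l (exposed S)) same (MemP.∈-map⁺ l t∈)

  ∈-rows : ∀ {S t} → t ∈ S → l t Mem.∈ rows S
  ∈-rows t∈ = MemP.∈-deduplicate⁺ ℤ._≟_ (MemP.∈-map⁺ l t∈)

module Right = Direction proj₁ proj₂ (λ c → (proj₁ c ℤ.+ ℤ.+ 1 , proj₂ c)) (λ _ → refl)
                         (λ c → ℤP.+-comm (proj₁ c) (ℤ.+ 1))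
module Left  = Direction (ℤ.-_ ∘ proj₁) proj₂ (λ c → (proj₁ c ℤ.- ℤ.+ 1 , proj₂ c)) (λ _ → refl)
                         (λ c → -[x-1]≡1-x (proj₁ c))
module Up    = Direction proj₂ proj₁ (λ c → (proj₁ c , proj₂ c ℤ.+ ℤ.+ 1)) (λ _ → refl)
                         (λ c → ℤP.+-comm (proj₂ c) (ℤ.+ 1))
module Down  = Direction (ℤ.-_ ∘ proj₂) proj₁ (λ c → (proj₁ c , proj₂ c ℤ.- ℤ.+ 1)) (λ _ → refl)
                         (λ c → -[x-1]≡1-x (proj₂ c))

width height : List Cell → ℕ
width  S = length (Up.rows S)
height S = length (Right.rows S)

perimeter-split : ∀ S → perimeter S ≡ length (Right.exposed S) + (length (Left.exposed S) +
                                       (length (Up.exposed S) + length (Down.exposed S)))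
perimeter-split S = begin
    ∑ (λ t → r t + (l t + (u t + (d t + 0)))) S
  ≡⟨ ∑-cong S (λ {t} _ → cong (λ z → r t + (l t + (u t + z))) (ℕP.+-identityʳ (d t))) ⟩
    ∑ (λ t → r t + (l t + (u t + d t))) S
  ≡⟨ trans (∑-+ r _ S) (cong (∑ r S +_) (trans (∑-+ l _ S) (cong (∑ l S +_) (∑-+ u d S)))) ⟩
    ∑ r S + (∑ l S + (∑ u S + ∑ d S))
  ≡⟨ sym (cong₂ _+_ (length-filter _ S) (cong₂ _+_ (length-filter _ S) (cong₂ _+_ (length-filter _ S) (length-filter _ S)))) ⟩
    length (Right.exposed S) + (length (Left.exposed S) + (length (Up.exposed S) + length (Down.exposed S)))
  ∎
  where
  open ≡-Reasoning
  r l u d : Cell → ℕ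
  r t = outside (proj₁ t ℤ.+ ℤ.+ 1 , proj₂ t) S
  l t = outside (proj₁ t ℤ.- ℤ.+ 1 , proj₂ t) S
  u t = outside (proj₁ t , proj₂ t ℤ.+ ℤ.+ 1) S
  d t = outside (proj₁ t , proj₂ t ℤ.- ℤ.+ 1) S

-- each row contributes a boundary edge on the right and one on the left,
-- each column one at the top and one at the bottom
perimeter-bound : ∀ S → 2 * (width S + height S) ≤ perimeter S
perimeter-bound S = subst₂ _≤_ (regroup (width S) (height S)) (sym (perimeter-split S))
  (ℕP.+-mono-≤ (Right.rows≤exposed S) (ℕP.+-mono-≤ (Left.rows≤exposed S)
  (ℕP.+-mono-≤ (Up.rows≤exposed S) (Down.rows≤exposed S))))
  where
  regroup : ∀ w h → h + (h + (w + w)) ≡ 2 * (w + h)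
  regroup = ℕS.solve-∀

-- S lies in the rectangle spanned by its columns and rows
area-bound : ∀ S → Unique S → length S ≤ width S * height S
area-bound S u = ℕP.≤-trans (unique-⊆-length S u in-rectangle)
                            (ℕP.≤-reflexive (length-cartesianProduct (Up.rows S) (Right.rows S)))
  where
  in-rectangle : ∀ {t} → t ∈ S → t ∈ cartesianProduct (Up.rows S) (Right.rows S)
  in-rectangle t∈ = MemP.∈-cartesianProduct⁺ (Up.∈-rows t∈) (Right.∈-rows t∈)

perimeter-single : ∀ c → perimeter (c ∷ []) ≡ 4
perimeter-single c = trans (ℕP.+-identityʳ _)
  (trans (∑-cong (neighbours c) (λ {d} c~d → outside-yes {d} {c ∷ []} λ { (here d≡c) → adj-≢ c~d (sym d≡c) }))
         (∑-length (neighbours c)))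

perimeter≥4 : ∀ {S t} → t ∈ S → 4 ≤ perimeter S
perimeter≥4 {S} t∈ = ℕP.≤-trans (ℕP.*-monoʳ-≤ 2 (ℕP.+-mono-≤ (length-pos (Up.∈-rows t∈)) (length-pos (Right.∈-rows t∈))))
                                (perimeter-bound S)

perimeter≡4 : ∀ {S t} → Unique S → t ∈ S → perimeter S ≡ 4 → length S ≡ 1
perimeter≡4 {S} {t} u t∈ P≡4 =
  ℕP.≤-antisym (ℕP.≤-trans (area-bound S u) (ℕP.≤-reflexive (cong₂ _*_ (sym (proj₁ one-by-one)) (sym (proj₂ one-by-one)))))
               (length-pos t∈)
  where
  one-by-one : 1 ≡ width S × 1 ≡ height S
  one-by-one = +-tight (length-pos (Up.∈-rows t∈)) (length-pos (Right.∈-rows t∈))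
                 (ℕP.≤-antisym (ℕP.*-cancelˡ-≤ 2 (ℕP.≤-trans (perimeter-bound S) (ℕP.≤-reflexive P≡4)))
                               (ℕP.+-mono-≤ (length-pos (Up.∈-rows t∈)) (length-pos (Right.∈-rows t∈))))

≤ᵇ-false : ∀ {x y} → (x ℕ.≤ᵇ y) ≡ false → ¬ (x ≤ y)
≤ᵇ-false eq x≤y = subst T eq (ℕP.≤⇒≤ᵇ x≤y)

≤ᵇ-true : ∀ {x y} → (x ℕ.≤ᵇ y) ≡ true → x ≤ y
≤ᵇ-true {x} {y} eq = ℕP.≤ᵇ⇒≤ x y (subst T (sym eq) tt)

ceilSqrtFrom-least : ∀ x fuel m M → m ≤ M → x ≤ M * M → ceilSqrtFrom x fuel m ≤ M
ceilSqrtFrom-least x zero       m M m≤M x≤M² = m≤M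
ceilSqrtFrom-least x (suc fuel) m M m≤M x≤M² with x ℕ.≤ᵇ m * m in eq
... | true  = m≤M
... | false = ceilSqrtFrom-least x fuel (suc m) M
                (ℕP.≰⇒> λ M≤m → ≤ᵇ-false eq (ℕP.≤-trans x≤M² (ℕP.*-mono-≤ M≤m M≤m))) x≤M²

ceilSqrtFrom-sound : ∀ x fuel m → x ≤ (m + fuel) * (m + fuel) →
                     x ≤ ceilSqrtFrom x fuel m * ceilSqrtFrom x fuel m
ceilSqrtFrom-sound x zero       m x≤ = subst (λ z → x ≤ z * z) (ℕP.+-identityʳ m) x≤
ceilSqrtFrom-sound x (suc fuel) m x≤ with x ℕ.≤ᵇ m * m in eq
... | true  = ≤ᵇ-true eq
... | false = ceilSqrtFrom-sound x fuel (suc m) (subst (λ z → x ≤ z * z) (ℕP.+-suc m fuel) x≤)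

ceilSqrt-least : ∀ x M → x ≤ M * M → ceilSqrt x ≤ M
ceilSqrt-least x M = ceilSqrtFrom-least x x 0 M z≤n

ceilSqrt-sound : ∀ x → x ≤ ceilSqrt x * ceilSqrt x
ceilSqrt-sound zero    = z≤n
ceilSqrt-sound (suc x) = ceilSqrtFrom-sound (suc x) (suc x) 0 (ℕP.m≤m*n (suc x) (suc x))

pmin-mono : ∀ {x y} → x ≤ y → pmin x ≤ pmin y
pmin-mono {x} {y} x≤y = ℕP.*-monoʳ-≤ 2 (ceilSqrt-least (4 * x) (ceilSqrt (4 * y))
                          (ℕP.≤-trans (ℕP.*-monoʳ-≤ 4 x≤y) (ceilSqrt-sound (4 * y))))

-- 4rc ≤ (r + c)², the arithmetic–geometric mean inequality: for c = r + d
-- the difference is d²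
am-gm-ordered : ∀ {r c} → r ≤ c → 4 * (r * c) ≤ (r + c) * (r + c)
am-gm-ordered {r} {c} r≤c = subst (λ c → 4 * (r * c) ≤ (r + c) * (r + c)) (ℕP.m+[n∸m]≡n r≤c)
  (subst (4 * (r * (r + (c ∸ r))) ≤_) (sym (square r (c ∸ r))) (ℕP.m≤m+n _ _))
  where
  square : ∀ r d → (r + (r + d)) * (r + (r + d)) ≡ 4 * (r * (r + d)) + d * d
  square = ℕS.solve-∀

am-gm : ∀ r c → 4 * (r * c) ≤ (r + c) * (r + c)
am-gm r c with ℕP.≤-total r c
... | inj₁ r≤c = am-gm-ordered r≤c
... | inj₂ c≤r = subst₂ _≤_ (cong (4 *_) (ℕP.*-comm c r)) (cong (λ z → z * z) (ℕP.+-comm c r)) (am-gm-ordered c≤r)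

pmin-rectangle : ∀ {n} r c → n ≤ r * c → pmin n ≤ 2 * (r + c)
pmin-rectangle {n} r c n≤rc = ℕP.*-monoʳ-≤ 2 (ceilSqrt-least (4 * n) (r + c)
                                (ℕP.≤-trans (ℕP.*-monoʳ-≤ 4 n≤rc) (am-gm r c)))

isoperimetric : ∀ S → Unique S → pmin (length S) ≤ perimeter S
isoperimetric S u = ℕP.≤-trans (pmin-rectangle (width S) (height S) (area-bound S u)) (perimeter-bound S)

module WithHoles {A hs} (pA : Polyomino A) (holes : Holes A hs) where

  U : List Cell
  U = concat hs

  hole : ∀ {H} → H Mem.∈ hs → IsHole A H
  hole = All.lookup (Holes.holes holes)

  U-empty : ∀ {c} → c ∈ U → c ∉ A
  U-empty c∈ with MemP.∈-concat⁻′ hs c∈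
  ... | H , c∈H , H∈ = All.lookup (IsHole.empty (hole H∈)) c∈H

  U-closed : ∀ {c d} → c ∈ U → Adj c d → d ∉ A → d ∈ U
  U-closed c∈ c~d d∉A with MemP.∈-concat⁻′ hs c∈
  ... | H , c∈H , H∈ = MemP.∈-concat⁺′ (IsHole.closed (hole H∈) c∈H c~d d∉A) H∈

  outer : Cell → ℕ
  outer d = χ (¬? (d ∈? A) ×-dec ¬? (d ∈? U))

  outerPerimeter-∑ : outerPerimeter A hs ≡ ∑ (λ t → ∑ outer (neighbours t)) A
  outerPerimeter-∑ = begin
      length (filter (λ e → ¬? (proj₂ e ∈? A) ×-dec ¬? (proj₂ e ∈? U)) (concatMap edges A))
    ≡⟨ length-filter _ (concatMap edges A) ⟩
      ∑ (outer ∘ proj₂) (concat (map edges A))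
    ≡⟨ ∑-concat (outer ∘ proj₂) (map edges A) ⟩
      ∑ (∑ (outer ∘ proj₂)) (map edges A)
    ≡⟨ ∑-map (∑ (outer ∘ proj₂)) edges A ⟩
      ∑ (∑ (outer ∘ proj₂) ∘ edges) A
    ≡⟨ ∑-cong A (λ {t} _ → ∑-map (outer ∘ proj₂) (t ,_) (neighbours t)) ⟩
      ∑ (λ t → ∑ outer (neighbours t)) A
    ∎
    where
    open ≡-Reasoning
    edges : Cell → List (Cell × Cell)
    edges t = map (t ,_) (neighbours t)

  -- a non-tile neighbour of a tile is either outer or in a hole
  perimeter-A : perimeter A ≡ outerPerimeter A hs + contacts A U
  perimeter-A = trans (∑-cong A (λ {t} _ → trans (∑-cong (neighbours t) (λ {d} _ → split d))
                                                  (∑-+ outer (λ d → inside d U) (neighbours t))))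
                      (trans (∑-+ _ _ A) (cong (_+ contacts A U) (sym outerPerimeter-∑)))
    where
    split : ∀ d → outside d A ≡ outer d + inside d U
    split d with d ∈? A | d ∈? U
    ... | yes d∈A | yes d∈U = ⊥-elim (U-empty d∈U d∈A)
    ... | yes _   | no _    = refl
    ... | no _    | yes _   = refl
    ... | no _    | no _    = refl

  -- every tile–hole contact is a boundary edge of exactly one hole
  contacts-holes : contacts A U ≡ ∑ perimeter hs
  contacts-holes = begin
      contacts A U
    ≡⟨ contacts-sym A U (Polyomino.distinct pA) (Holes.disjoint holes) ⟩
      ∑ (λ c → neighboursIn c A) U
    ≡⟨ ∑-cong U (λ {c} c∈ → ∑-cong (neighbours c) (λ {d} c~d →
         inside-complement {d} (λ d∈A d∈U → U-empty d∈U d∈A) (U-closed c∈ c~d))) ⟩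
      ∑ (λ c → neighboursOut c U) (concat hs)
    ≡⟨ ∑-concat _ hs ⟩
      ∑ (∑ (λ c → neighboursOut c U)) hs
    ≡⟨ ∑-cong hs (λ {H} H∈ → ∑-cong H (λ {c} c∈H → ∑-cong (neighbours c) (λ {d} c~d →
         outside-iff {d} (λ d∈U → IsHole.closed (hole H∈) c∈H c~d (U-empty d∈U))
                         (λ d∈H → MemP.∈-concat⁺′ d∈H H∈)))) ⟩
      ∑ perimeter hs
    ∎
    where open ≡-Reasoning

  filled-perimeter : perimeter (A ++ U) ≡ outerPerimeter A hs
  filled-perimeter = begin
      ∑ (λ t → neighboursOut t (A ++ U)) (A ++ U)
    ≡⟨ ∑-++ _ A U ⟩
      ∑ (λ t → neighboursOut t (A ++ U)) A + ∑ (λ t → neighboursOut t (A ++ U)) U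
    ≡⟨ cong₂ _+_ (∑-cong A (λ {t} _ → ∑-cong (neighbours t) (λ {d} _ → outside-++ d)))
                 (trans (∑-cong U (λ {c} c∈ → ∑-cong (neighbours c) (λ {d} c~d → enclosed c∈ c~d)))
                        (trans (∑-cong U (λ {c} _ → ∑-zero (neighbours c))) (∑-zero U))) ⟩
      ∑ (λ t → ∑ outer (neighbours t)) A + 0
    ≡⟨ trans (ℕP.+-identityʳ _) (sym outerPerimeter-∑) ⟩
      outerPerimeter A hs
    ∎
    where
    open ≡-Reasoning
    outside-++ : ∀ d → outside d (A ++ U) ≡ outer d
    outside-++ d with d ∈? A | d ∈? U
    ... | yes d∈A | _       = outside-no (MemP.∈-++⁺ˡ d∈A)
    ... | no _    | yes d∈U = outside-no (MemP.∈-++⁺ʳ A d∈U)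
    ... | no d∉A  | no d∉U  = outside-yes ([ d∉A , d∉U ]′ ∘ MemP.∈-++⁻ A)
    enclosed : ∀ {c d} → c ∈ U → Adj c d → outside d (A ++ U) ≡ 0
    enclosed {c} {d} c∈ c~d with d ∈? A
    ... | yes d∈A = outside-no (MemP.∈-++⁺ˡ d∈A)
    ... | no d∉A  = outside-no (MemP.∈-++⁺ʳ A (U-closed c∈ c~d d∉A))

  n h : ℕ
  n = length A
  h = length hs

  perimeter-identity : 4 * n ≡ contacts A A + (outerPerimeter A hs + ∑ perimeter hs)
  perimeter-identity = trans (sym (contacts+perimeter A))
                             (cong (contacts A A +_) (trans perimeter-A (cong (outerPerimeter A hs +_) contacts-holes)))

  -- p_o ≥ p_min(n + |U|) ≥ p_min(n + h), as every hole has a cell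
  outer-bound : pmin (n + h) ≤ outerPerimeter A hs
  outer-bound = ℕP.≤-trans (pmin-mono (ℕP.+-monoʳ-≤ n h≤|U|))
                (ℕP.≤-trans (ℕP.≤-reflexive (cong pmin (sym (ListP.length-++ A))))
                (ℕP.≤-trans (isoperimetric (A ++ U) filled-unique) (ℕP.≤-reflexive filled-perimeter)))
    where
    h≤|U| : h ≤ length U
    h≤|U| = ℕP.≤-trans (ℕP.≤-reflexive (sym (∑-length hs)))
            (ℕP.≤-trans (∑-mono hs (λ H∈ → length-pos (proj₂ (nonempty-member (IsHole.nonempty (hole H∈))))))
            (ℕP.≤-reflexive (trans (∑-cong hs (λ {H} _ → sym (∑-length H)))
                            (trans (sym (∑-concat (λ _ → 1) hs)) (∑-length U)))))
    filled-unique : Unique (A ++ U)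
    filled-unique = ++⁺ (Polyomino.distinct pA) (Holes.disjoint holes) (λ (c∈A , c∈U) → U-empty c∈U c∈A)

  holes-bound : 4 * h ≤ ∑ perimeter hs
  holes-bound = ℕP.≤-trans (ℕP.≤-reflexive (sym (∑-const 4 hs)))
    (∑-mono hs (λ H∈ → perimeter≥4 (proj₂ (nonempty-member (IsHole.nonempty (hole H∈))))))

  holes-tight : ∑ perimeter hs ≡ 4 * h → All (λ H → area H ≡ 1) hs
  holes-tight eq = All.tabulate λ H∈ →
    perimeter≡4 (IsHole.distinct (hole H∈)) (proj₂ (nonempty-member (IsHole.nonempty (hole H∈))))
                (∑-tight hs (λ H∈ → perimeter≥4 (proj₂ (nonempty-member (IsHole.nonempty (hole H∈)))))
                         (trans eq (sym (∑-const 4 hs))) H∈)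

  unit-holes : All (λ H → area H ≡ 1) hs → ∑ perimeter hs ≡ 4 * h
  unit-holes area1 = trans (∑-cong hs (λ {H} H∈ → unit-perimeter H (All.lookup area1 H∈))) (∑-const 4 hs)
    where
    unit-perimeter : ∀ H → length H ≡ 1 → perimeter H ≡ 4
    unit-perimeter (c ∷ []) _ = perimeter-single c

pos-≡-minus : ∀ a b c → ℤ.+ a ≡ ℤ.+ b ℤ.- ℤ.+ c ⇔ a + c ≡ b
pos-≡-minus a b c = mk⇔
  (λ eq → ℤP.+-injective (trans (ℤP.pos-+ a c) (trans (cong (ℤ._+ ℤ.+ c) eq) (minus-plus (ℤ.+ b) (ℤ.+ c)))))
  (λ eq → trans (sym (plus-minus (ℤ.+ a) (ℤ.+ c))) (cong (ℤ._- ℤ.+ c) (trans (sym (ℤP.pos-+ a c)) (cong ℤ.+_ eq))))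
  where
  minus-plus : ∀ x y → x ℤ.- y ℤ.+ y ≡ x
  minus-plus = solve-∀
  plus-minus : ∀ x y → x ℤ.+ y ℤ.- y ≡ x
  plus-minus = solve-∀

-- Given 4n = 2e + (p + q), the equation 4h = 2n + 2 - m says that the lower
-- bounds 2n ≤ 2(e + 1), m ≤ p, 4h ≤ q add up to the upper bounds.
budget : ∀ n e p q h m → 4 * n ≡ 2 * e + (p + q) →
         ℤ.+ (4 * h) ≡ ℤ.+ (2 * n + 2) ℤ.- ℤ.+ m ⇔ 2 * n + (m + 4 * h) ≡ 2 * suc e + (p + q)
budget n e p q h m identity = ⇔-trans (pos-≡-minus (4 * h) (2 * n + 2) m) (mk⇔
  (λ eq → trans (cong (2 * n +_) (trans (ℕP.+-comm m (4 * h)) eq)) (trans (double n) (sym upper)))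
  (λ eq → trans (ℕP.+-comm (4 * h) m) (ℕP.+-cancelˡ-≡ (2 * n) _ _ (trans eq (trans upper (sym (double n)))))))
  where
  double : ∀ n → 2 * n + (2 * n + 2) ≡ 4 * n + 2
  double = ℕS.solve-∀
  shift : ∀ e r → 2 * suc e + r ≡ (2 * e + r) + 2
  shift = ℕS.solve-∀
  upper : 2 * suc e + (p + q) ≡ 4 * n + 2
  upper = trans (shift e (p + q)) (cong (_+ 2) (sym identity))

-- A is efficiently structured iff 4h = 2n + 2 - p_min(n + h): by the perimeter
-- identity the latter says that the three bounds 2n ≤ 2(e + 1),
-- p_min(n + h) ≤ p_o and 4h ≤ Σ_H P(H) are all attained, which means exactly
-- that A is acyclic, has minimal outer perimeter and has only unit holes.
mainTheorem9 : (A : List Cell) (hs : List (List Cell)) →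
    Polyomino A → Holes A hs →
    EfficientlyStructured A hs ⇔ EqualsM (length A) (length hs)
mainTheorem9 A hs pA holes = mk⇔ to from
  where
  open DualEdges (dual-edges pA)
  open WithHoles pA holes
  equation : EqualsM n h ⇔ 2 * n + (pmin (n + h) + 4 * h) ≡ 2 * suc edges + (outerPerimeter A hs + ∑ perimeter hs)
  equation = budget n edges (outerPerimeter A hs) (∑ perimeter hs) h (pmin (n + h))
                    (trans perimeter-identity (cong (_+ (outerPerimeter A hs + ∑ perimeter hs)) double-count))
  to : EfficientlyStructured A hs → EqualsM n h
  to (acyclic , area1 , minimal) = Equivalence.from equation
    (cong₂ (λ a b → 2 * a + b) (sym (Equivalence.to tree-iff acyclic)) (cong₂ _+_ (sym minimal) (sym (unit-holes area1))))
  from : EqualsM n h → EfficientlyStructured A hs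
  from eq with +-tight (ℕP.*-monoʳ-≤ 2 spanning) (ℕP.+-mono-≤ outer-bound holes-bound) (sym (Equivalence.to equation eq))
  ... | tree , rest with +-tight outer-bound holes-bound (sym rest)
  ...   | minimal , tight =
    Equivalence.from tree-iff (sym (ℕP.*-cancelˡ-≡ n (suc edges) 2 tree)) , holes-tight (sym tight) , sym minimal
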